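{- $Z(d)=d$ for $d\in\{2,3\}$ and $Z(d)=d+1$ for $d\in\{4,5\}$. Moreover, $Z(d)\ge d+1$ for every integer $d\ge 4$.
   Context: All graphs are finite, simple and undirected. A graph is triangle-free if it has no three pairwise adjacent vertices. $\nu(G)$ is the matching number of $G$. A graph $G$ is factor-critical if $G-v$ has a perfect matching for every vertex $v$. A graph is almost $d$-regular if one vertex has degree $d-1$ and all other vertices have degree $d$. For $d\ge 2$, $Z(d)$ is the smallest positive integer $n$ such that there exists a triangle-free factor-critical graph $G$ with $\nu(G)=n$ that is $d$-regular (if $d$ is even) or almost $d$-regular (if $d$ is odd). -}

module Defs where

open import Data.Nat using (ℕ; zero; suc; _+_; _∸_; _<_; _≤_; _%_)
open import Data.Fin using (Fin)
open import Data.Bool using (Bool; true; false; if_then_else_)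
open import Data.List using (List; []; _∷_; length; map; allFin; concatMap)
open import Data.Nat.ListAction using (sum)
open import Data.List.Membership.Propositional using (_∈_)
open import Data.List.Relation.Unary.All using (All)
open import Data.List.Relation.Unary.Unique.Propositional using (Unique)
open import Data.Product using (Σ; _×_; _,_; ∃; proj₁; proj₂)
open import Data.Empty using (⊥)
open import Relation.Nullary using (¬_)
open import Relation.Binary.PropositionalEquality using (_≡_; _≢_)

record Graph : Set where
  field
    n     : ℕ
    adj   : Fin n → Fin n → Bool
    sym   : ∀ u v → adj u v ≡ adj v u
    loopless : ∀ v → adj v v ≡ false

module _ (G : Graph) where
  open Graph G

  Edge : Fin n → Fin n → Set
  Edge u v = adj u v ≡ true

  degree : Fin n → ℕ
  degree v = sum (map (λ u → if adj v u then 1 else 0) (allFin n))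

  TriangleFree : Set
  TriangleFree = ∀ u v w → Edge u v → Edge v w → Edge u w → ⊥

  covered : List (Fin n × Fin n) → List (Fin n)
  covered M = concatMap (λ e → proj₁ e ∷ proj₂ e ∷ []) M

  IsMatching : List (Fin n × Fin n) → Set
  IsMatching M = All (λ e → Edge (proj₁ e) (proj₂ e)) M × Unique (covered M)

  MatchingNumber : ℕ → Set
  MatchingNumber k =
    (Σ (List (Fin n × Fin n)) λ M → IsMatching M × length M ≡ k) ×
    (∀ M → IsMatching M → length M ≤ k)

  FactorCritical : Set
  FactorCritical = ∀ v → Σ (List (Fin n × Fin n)) λ M →
    IsMatching M × ¬ (v ∈ covered M) × (∀ u → u ≢ v → u ∈ covered M)

  Regular : ℕ → Set
  Regular d = ∀ v → degree v ≡ d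

  AlmostRegular : ℕ → Set
  AlmostRegular d = Σ (Fin n) λ v → degree v ≡ d ∸ 1 × (∀ u → u ≢ v → degree u ≡ d)

  DegreeCondition : ℕ → Set
  DegreeCondition d = (d % 2 ≡ 0 → Regular d) × (d % 2 ≡ 1 → AlmostRegular d)

Realizable : ℕ → ℕ → Set
Realizable d k = Σ Graph λ G →
  TriangleFree G × FactorCritical G × MatchingNumber G k × DegreeCondition G d

IsZ : ℕ → ℕ → Set
IsZ d m = 0 < m × Realizable d m × (∀ k → 0 < k → k < m → ¬ Realizable d k)

-- A factor-critical graph with ν(G) = k has 2k + 1 vertices, and the degree condition says that all
-- degrees equal d except for a total deficit of at most one.  Hence some edge uv joins two vertices of
-- degree d, and since G is triangle-free N(u) and N(v) are disjoint: 2d ≤ 2k + 1, so k ≥ d.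
-- If k = d ≥ 4, exactly one vertex w lies outside N(u) ∪ N(v).  If w has neighbours x ∈ N(u) and
-- y ∈ N(v), then u v y w x is a pentagon; every vertex sees at most two of its vertices, so its degree
-- sum is at most 2n = 4d + 2, while it is at least 5d − 1.  Otherwise N(u) (or N(v)) is one side of a
-- bipartition with sides of sizes d and d + 1, and double counting the edges gives d(d + 1) − 1 ≤ d².
-- The upper bounds are explicit graphs on 5, 7, 11 and 13 vertices, checked by evaluation.

module Submission where

open import Defs
open import Data.Nat.Properties renaming (_≟_ to _≟ℕ_)
open import Algebra.Properties.Semiring.Sum +-*-semiring
  using (sum; sum-syntax; sum-cong-≗; ∑-distrib-+; ∑-comm; *-distribˡ-sum; *-distribʳ-sum)
open import Data.Bool using (Bool; true; false; not; _∨_; if_then_else_)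
open import Data.Bool.Properties using () renaming (_≟_ to _≟ᵇ_)
open import Data.Empty using (⊥; ⊥-elim)
open import Data.Fin using (Fin; zero; suc; toℕ; fromℕ<)
open import Data.Fin.Properties using (_≟_; all?; any?)
open import Data.List using (List; []; _∷_; map; tabulate; length; applyUpTo)
open import Data.List.Membership.Propositional using (_∈_)
import Data.List.Membership.DecPropositional as DecMembership
open import Data.List.Relation.Unary.All as All using ([]; _∷_)
open import Data.List.Relation.Unary.All.Properties using (All¬⇒¬Any; ¬Any⇒All¬)
open import Data.List.Relation.Unary.AllPairs using ([]; _∷_)
open import Data.List.Relation.Unary.Any using (here; there)
open import Data.List.Relation.Unary.Unique.Propositional using (Unique)
open import Data.Nat using (ℕ; zero; suc; _+_; _*_; _∸_; _<_; _≤_; _%_; z≤n; s≤s; z<s; _<?_)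
open import Data.Nat.DivMod using (m%n<n)
open import Data.Nat.ListAction using () renaming (sum to sumᴸ)
open import Data.Nat.Tactic.RingSolver using (solve-∀)
open import Data.Product using (∃; _×_; _,_; proj₁; proj₂)
open import Data.Sum using (_⊎_; inj₁; inj₂)
open import Function using (_∘_)
open import Relation.Binary.PropositionalEquality hiding ([_])
open import Relation.Nullary using (¬_; Dec; yes; no; does; ¬?; contradiction)
open import Relation.Nullary.Decidable using (True; toWitness; dec-true; dec-false; _×-dec_; _→-dec_)

open DecMembership _≟ℕ_ using () renaming (_∈?_ to _∈ℕ?_)

module _ {n : ℕ} where
  open DecMembership (_≟_ {n}) public using (_∈?_)
  open import Data.List.Relation.Unary.Unique.DecPropositional (_≟_ {n}) public using (unique?)

-- Counting over Fin n

-- The Iverson bracket, spelled as in the definition of degree so that the two agree definitionally.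
[_] : Bool → ℕ
[ b ] = if b then 1 else 0

[]≤1 : ∀ b → [ b ] ≤ 1
[]≤1 true  = ≤-refl
[]≤1 false = z≤n

[]+[not]≡1 : ∀ b → [ b ] + [ not b ] ≡ 1
[]+[not]≡1 true  = refl
[]+[not]≡1 false = refl

[∨]≡[]+[] : ∀ a b → [ a ] + [ b ] ≤ 1 → [ a ∨ b ] ≡ [ a ] + [ b ]
[∨]≡[]+[] true  true  (s≤s ())
[∨]≡[]+[] true  false _ = refl
[∨]≡[]+[] false b     _ = refl

[]*≤ : ∀ b m → [ b ] * m ≤ m
[]*≤ true  m = ≤-reflexive (+-identityʳ m)
[]*≤ false m = z≤n

<[]⇒ : ∀ {m} b → m < [ b ] → b ≡ true × m ≡ 0
<[]⇒ true  m<1 = refl , n<1⇒n≡0 m<1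

sumᴸ-map-const : ∀ {A : Set} c (L : List A) → sumᴸ (map (λ _ → c) L) ≡ length L * c
sumᴸ-map-const c []      = refl
sumᴸ-map-const c (_ ∷ L) = cong (c +_) (sumᴸ-map-const c L)

sumᴸ-map-tabulate : ∀ {n} {A : Set} (f : A → ℕ) (g : Fin n → A) →
                    sumᴸ (map f (tabulate g)) ≡ ∑[ i < n ] f (g i)
sumᴸ-map-tabulate {zero}  f g = refl
sumᴸ-map-tabulate {suc n} f g = cong (f (g zero) +_) (sumᴸ-map-tabulate f (g ∘ suc))

∑-mono-≤ : ∀ {n} {f g : Fin n → ℕ} → (∀ i → f i ≤ g i) → sum f ≤ sum g
∑-mono-≤ {zero}  f≤g = z≤n
∑-mono-≤ {suc n} f≤g = +-mono-≤ (f≤g zero) (∑-mono-≤ (f≤g ∘ suc))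

∑-const : ∀ n c → ∑[ i < n ] c ≡ n * c
∑-const zero    c = refl
∑-const (suc n) c = cong (c +_) (∑-const n c)

∑-zero : ∀ n → ∑[ i < n ] 0 ≡ 0
∑-zero n = trans (∑-const n 0) (*-zeroʳ n)

∑-one : ∀ n → ∑[ i < n ] 1 ≡ n
∑-one n = trans (∑-const n 1) (*-identityʳ n)

∑-*ʳ : ∀ {n} (f : Fin n → ℕ) c → ∑[ i < n ] (f i * c) ≡ sum f * c
∑-*ʳ f c = sym (*-distribʳ-sum c f)

∑-complement : ∀ {n} (p : Fin n → Bool) → ∑[ i < n ] [ p i ] + ∑[ i < n ] [ not (p i) ] ≡ n
∑-complement {n} p = begin
  ∑[ i < n ] [ p i ] + ∑[ i < n ] [ not (p i) ]
    ≡⟨ ∑-distrib-+ (λ i → [ p i ]) (λ i → [ not (p i) ]) ⟨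
  ∑[ i < n ] ([ p i ] + [ not (p i) ])
    ≡⟨ sum-cong-≗ (λ i → []+[not]≡1 (p i)) ⟩
  ∑[ i < n ] 1
    ≡⟨ ∑-one n ⟩
  n ∎
  where open ≡-Reasoning

∑<∑⇒∃< : ∀ {n} (f g : Fin n → ℕ) → sum f < sum g → ∃ λ i → f i < g i
∑<∑⇒∃< {zero}  f g ()
∑<∑⇒∃< {suc n} f g ∑f<∑g with f zero <? g zero
... | yes f₀<g₀ = zero , f₀<g₀
... | no  f₀≮g₀ with ∑<∑⇒∃< (f ∘ suc) (g ∘ suc)
                     (+-cancelˡ-< (f zero) _ _ (<-≤-trans ∑f<∑g (+-monoˡ-≤ _ (≮⇒≥ f₀≮g₀))))
...   | i , fᵢ<gᵢ = suc i , fᵢ<gᵢ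

∑-[≟]* : ∀ {n} (x : Fin n) (f : Fin n → ℕ) → ∑[ z < n ] ([ does (z ≟ x) ] * f z) ≡ f x
∑-[≟]* {suc n} zero    f = trans (cong₂ _+_ (+-identityʳ (f zero)) (∑-zero n)) (+-identityʳ (f zero))
∑-[≟]* {suc n} (suc x) f = ∑-[≟]* x (f ∘ suc)

∑-[∈]* : ∀ {n} {L : List (Fin n)} → Unique L → (f : Fin n → ℕ) →
         ∑[ z < n ] ([ does (z ∈? L) ] * f z) ≡ sumᴸ (map f L)
∑-[∈]* {n} {[]}    _          f = ∑-zero n
∑-[∈]* {n} {x ∷ L} (x∉L ∷ uL) f = begin
  ∑[ z < n ] ([ does (z ∈? x ∷ L) ] * f z)
    ≡⟨ sum-cong-≗ split ⟩
  ∑[ z < n ] ([ does (z ≟ x) ] * f z + [ does (z ∈? L) ] * f z)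
    ≡⟨ ∑-distrib-+ (λ z → [ does (z ≟ x) ] * f z) _ ⟩
  ∑[ z < n ] ([ does (z ≟ x) ] * f z) + ∑[ z < n ] ([ does (z ∈? L) ] * f z)
    ≡⟨ cong₂ _+_ (∑-[≟]* x f) (∑-[∈]* uL f) ⟩
  f x + sumᴸ (map f L) ∎
  where
  open ≡-Reasoning
  split : ∀ z → [ does (z ≟ x) ∨ does (z ∈? L) ] * f z
              ≡ [ does (z ≟ x) ] * f z + [ does (z ∈? L) ] * f z
  split z with z ≟ x
  ... | no _     = refl
  ... | yes refl rewrite dec-false (z ∈? L) (All¬⇒¬Any x∉L) = sym (+-identityʳ _)

sumᴸ-map≤∑ : ∀ {n} {L : List (Fin n)} → Unique L → (f : Fin n → ℕ) → sumᴸ (map f L) ≤ sum f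
sumᴸ-map≤∑ {L = L} uL f =
  subst (_≤ sum f) (∑-[∈]* uL f) (∑-mono-≤ (λ z → []*≤ (does (z ∈? L)) (f z)))

∑-[∈]≡length : ∀ {n} {L : List (Fin n)} → Unique L → ∑[ z < n ] [ does (z ∈? L) ] ≡ length L
∑-[∈]≡length {n} {L} uL = begin
  ∑[ z < n ] [ does (z ∈? L) ]        ≡⟨ sum-cong-≗ (λ z → *-identityʳ [ does (z ∈? L) ]) ⟨
  ∑[ z < n ] ([ does (z ∈? L) ] * 1)  ≡⟨ ∑-[∈]* uL (λ _ → 1) ⟩
  sumᴸ (map (λ _ → 1) L)              ≡⟨ sumᴸ-map-const 1 L ⟩
  length L * 1                        ≡⟨ *-identityʳ (length L) ⟩
  length L                            ∎
  where open ≡-Reasoning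

unique⇒length≤ : ∀ {n} {L : List (Fin n)} → Unique L → length L ≤ n
unique⇒length≤ {n} {L} uL = begin
  length L                      ≡⟨ ∑-[∈]≡length uL ⟨
  ∑[ z < n ] [ does (z ∈? L) ]  ≤⟨ ∑-mono-≤ (λ z → []≤1 (does (z ∈? L))) ⟩
  ∑[ z < n ] 1                  ≡⟨ ∑-one n ⟩
  n                             ∎
  where open ≤-Reasoning

unique∧covering⇒length≡ : ∀ {n} {L : List (Fin n)} → Unique L → (∀ z → z ∈ L) → length L ≡ n
unique∧covering⇒length≡ {n} {L} uL covering = begin
  length L                      ≡⟨ ∑-[∈]≡length uL ⟨
  ∑[ z < n ] [ does (z ∈? L) ]  ≡⟨ sum-cong-≗ (λ z → cong [_] (dec-true (z ∈? L) (covering z))) ⟩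
  ∑[ z < n ] 1                  ≡⟨ ∑-one n ⟩
  n                             ∎
  where open ≡-Reasoning

half-≤ : ∀ {m k} → m + m ≤ suc (k + k) → m ≤ k
half-≤ {zero}          _ = z≤n
half-≤ {suc m} {zero}  (s≤s h) = contradiction (subst (_≤ 0) (+-suc m m) h) λ ()
half-≤ {suc m} {suc k} (s≤s h) rewrite +-suc m m | +-suc k k = s≤s (half-≤ (≤-pred h))

double-injective : ∀ {m k} → m + m ≡ k + k → m ≡ k
double-injective {m} {k} eq =
  ≤-antisym (half-≤ (m≤n⇒m≤1+n (≤-reflexive eq))) (half-≤ (m≤n⇒m≤1+n (≤-reflexive (sym eq))))

parity : ∀ d → d % 2 ≡ 0 ⊎ d % 2 ≡ 1
parity d with d % 2 | m%n<n d 2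
... | 0           | _ = inj₁ refl
... | 1           | _ = inj₂ refl
... | suc (suc _) | s≤s (s≤s ())

-- Graphs

module _ (G : Graph) where
  open Graph G renaming (sym to adj-sym)

  degree-∑ : ∀ v → degree G v ≡ ∑[ u < n ] [ adj v u ]
  degree-∑ v = sumᴸ-map-tabulate (λ u → [ adj v u ]) (λ u → u)

  Edge-sym : ∀ {u v} → Edge G u v → Edge G v u
  Edge-sym {u} {v} uv = trans (adj-sym v u) uv

  Edge⇒≢ : ∀ {u v} → Edge G u v → u ≢ v
  Edge⇒≢ {u} uu refl with trans (sym uu) (loopless u)
  ... | ()

  Edge? : ∀ u v → Dec (Edge G u v)
  Edge? u v = adj u v ≟ᵇ true

  sumᴸ-map-degree : ∀ (L : List (Fin n)) →
                    sumᴸ (map (degree G) L) ≡ ∑[ z < n ] sumᴸ (map (λ a → [ adj a z ]) L)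
  sumᴸ-map-degree []      = sym (∑-zero n)
  sumᴸ-map-degree (a ∷ L) = begin
    degree G a + sumᴸ (map (degree G) L)
      ≡⟨ cong₂ _+_ (degree-∑ a) (sumᴸ-map-degree L) ⟩
    ∑[ z < n ] [ adj a z ] + ∑[ z < n ] sumᴸ (map (λ b → [ adj b z ]) L)
      ≡⟨ ∑-distrib-+ (λ z → [ adj a z ]) (λ z → sumᴸ (map (λ b → [ adj b z ]) L)) ⟨
    ∑[ z < n ] ([ adj a z ] + sumᴸ (map (λ b → [ adj b z ]) L))
      ∎
    where open ≡-Reasoning

  bipartite-degree-sums : (side : Fin n → Bool) → (∀ x z → Edge G x z → side z ≡ not (side x)) →
    ∑[ x < n ] ([ side x ] * degree G x) ≡ ∑[ z < n ] ([ not (side z) ] * degree G z)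
  bipartite-degree-sums side crossing = begin
    ∑[ x < n ] ([ side x ] * degree G x)
      ≡⟨ sum-cong-≗ (λ x → *-degree [ side x ] x) ⟩
    ∑[ x < n ] ∑[ z < n ] ([ side x ] * [ adj x z ])
      ≡⟨ sum-cong-≗ (λ x → sum-cong-≗ (edge-term x)) ⟩
    ∑[ x < n ] ∑[ z < n ] ([ not (side z) ] * [ adj z x ])
      ≡⟨ ∑-comm (λ x z → [ not (side z) ] * [ adj z x ]) ⟩
    ∑[ z < n ] ∑[ x < n ] ([ not (side z) ] * [ adj z x ])
      ≡⟨ sum-cong-≗ (λ z → *-degree [ not (side z) ] z) ⟨
    ∑[ z < n ] ([ not (side z) ] * degree G z)
      ∎
    where
    open ≡-Reasoning
    *-degree : ∀ c x → c * degree G x ≡ ∑[ z < n ] (c * [ adj x z ])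
    *-degree c x = trans (cong (c *_) (degree-∑ x)) (*-distribˡ-sum c (λ z → [ adj x z ]))
    edge-term : ∀ x z → [ side x ] * [ adj x z ] ≡ [ not (side z) ] * [ adj z x ]
    edge-term x z rewrite adj-sym z x with adj x z in xz
    ... | false = trans (*-zeroʳ [ side x ]) (sym (*-zeroʳ [ not (side z) ]))
    ... | true  rewrite crossing x z xz with side x
    ...   | true  = refl
    ...   | false = refl

  module _ (triangle-free : TriangleFree G) where

    neighbourhoods-disjoint : ∀ {u v} → Edge G u v → ∀ z → [ adj u z ] + [ adj v z ] ≤ 1
    neighbourhoods-disjoint {u} {v} uv z with adj u z in uz | adj v z in vz
    ... | true  | true  = ⊥-elim (triangle-free u v z uv vz uz)
    ... | true  | false = ≤-refl
    ... | false | b     = []≤1 b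

    ∑[∨]≡degree+degree : ∀ {u v} → Edge G u v →
                         ∑[ z < n ] [ adj u z ∨ adj v z ] ≡ degree G u + degree G v
    ∑[∨]≡degree+degree {u} {v} uv = begin
      ∑[ z < n ] [ adj u z ∨ adj v z ]
        ≡⟨ sum-cong-≗ (λ z → [∨]≡[]+[] (adj u z) (adj v z) (neighbourhoods-disjoint uv z)) ⟩
      ∑[ z < n ] ([ adj u z ] + [ adj v z ])
        ≡⟨ ∑-distrib-+ (λ z → [ adj u z ]) (λ z → [ adj v z ]) ⟩
      ∑[ z < n ] [ adj u z ] + ∑[ z < n ] [ adj v z ]
        ≡⟨ cong₂ _+_ (degree-∑ u) (degree-∑ v) ⟨
      degree G u + degree G v ∎
      where open ≡-Reasoning

    degree+degree≤order : ∀ {u v} → Edge G u v → degree G u + degree G v ≤ n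
    degree+degree≤order {u} {v} uv = begin
      degree G u + degree G v           ≡⟨ ∑[∨]≡degree+degree uv ⟨
      ∑[ z < n ] [ adj u z ∨ adj v z ]  ≤⟨ ∑-mono-≤ (λ z → []≤1 (adj u z ∨ adj v z)) ⟩
      ∑[ z < n ] 1                      ≡⟨ ∑-one n ⟩
      n                                 ∎
      where open ≤-Reasoning

    -- Every vertex is adjacent to an independent set of the pentagon, hence to at most two of its vertices.
    pentagon-degree-sum : ∀ {a b c d e} →
                          Edge G a b → Edge G b c → Edge G c d → Edge G d e → Edge G e a →
                          sumᴸ (map (degree G) (a ∷ b ∷ c ∷ d ∷ e ∷ [])) ≤ n * 2
    pentagon-degree-sum {a} {b} {c} {d} {e} ab bc cd de ea = begin
      sumᴸ (map (degree G) (a ∷ b ∷ c ∷ d ∷ e ∷ []))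
        ≡⟨ sumᴸ-map-degree (a ∷ b ∷ c ∷ d ∷ e ∷ []) ⟩
      ∑[ z < n ] ([ adj a z ] + ([ adj b z ] + ([ adj c z ] + ([ adj d z ] + ([ adj e z ] + 0)))))
        ≤⟨ ∑-mono-≤ (λ z → independent-in-pentagon (adj a z) (adj b z) (adj c z) (adj d z) (adj e z)
                             (neighbourhoods-disjoint ab z) (neighbourhoods-disjoint bc z)
                             (neighbourhoods-disjoint cd z) (neighbourhoods-disjoint de z)
                             (neighbourhoods-disjoint ea z)) ⟩
      ∑[ z < n ] 2
        ≡⟨ ∑-const n 2 ⟩
      n * 2 ∎
      where
      open ≤-Reasoning
      independent-in-pentagon : ∀ a b c d e →
        [ a ] + [ b ] ≤ 1 → [ b ] + [ c ] ≤ 1 → [ c ] + [ d ] ≤ 1 → [ d ] + [ e ] ≤ 1 →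
        [ e ] + [ a ] ≤ 1 →
        [ a ] + ([ b ] + ([ c ] + ([ d ] + ([ e ] + 0)))) ≤ 2
      independent-in-pentagon true  true  _     _     _     (s≤s ()) _ _ _ _
      independent-in-pentagon true  false _     _     true  _ _ _ _ (s≤s ())
      independent-in-pentagon true  false true  true  false _ _ (s≤s ()) _ _
      independent-in-pentagon true  false true  false false _ _ _ _ _ = ≤-refl
      independent-in-pentagon true  false false true  false _ _ _ _ _ = ≤-refl
      independent-in-pentagon true  false false false false _ _ _ _ _ = s≤s z≤n
      independent-in-pentagon false true  true  _     _     _ (s≤s ()) _ _ _
      independent-in-pentagon false true  false true  true  _ _ _ (s≤s ()) _
      independent-in-pentagon false true  false true  false _ _ _ _ _ = ≤-refl
      independent-in-pentagon false true  false false true  _ _ _ _ _ = ≤-refl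
      independent-in-pentagon false true  false false false _ _ _ _ _ = s≤s z≤n
      independent-in-pentagon false false true  true  _     _ _ (s≤s ()) _ _
      independent-in-pentagon false false true  false true  _ _ _ _ _ = ≤-refl
      independent-in-pentagon false false true  false false _ _ _ _ _ = s≤s z≤n
      independent-in-pentagon false false false true  true  _ _ _ (s≤s ()) _
      independent-in-pentagon false false false true  false _ _ _ _ _ = s≤s z≤n
      independent-in-pentagon false false false false true  _ _ _ _ _ = s≤s z≤n
      independent-in-pentagon false false false false false _ _ _ _ _ = z≤n

    -- The complement of N(u) is N(v) ∪ {w}, an independent set, so N(u) is one side of a bipartition.
    neighbourhood-side : ∀ {u v w} → Edge G u v →
      (∀ z → adj u z ≡ false → adj v z ≡ false → z ≡ w) →
      (∀ y → Edge G v y → Edge G w y → ⊥) →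
      ∀ x z → Edge G x z → adj u z ≡ not (adj u x)
    neighbourhood-side {u} {v} {w} uv outside-is-w w↮N[v] x z xz
      with adj u x in ux | adj u z in uz
    ... | true  | true  = ⊥-elim (triangle-free u x z ux xz uz)
    ... | true  | false = refl
    ... | false | true  = refl
    ... | false | false = ⊥-elim (outside-edge (in-N[v]-or-w x ux) (in-N[v]-or-w z uz))
      where
      in-N[v]-or-w : ∀ y → adj u y ≡ false → Edge G v y ⊎ y ≡ w
      in-N[v]-or-w y uy with adj v y in vy
      ... | true  = inj₁ refl
      ... | false = inj₂ (outside-is-w y uy vy)
      outside-edge : Edge G v x ⊎ x ≡ w → Edge G v z ⊎ z ≡ w → ⊥
      outside-edge (inj₁ vx)   (inj₁ vz)   = triangle-free v x z vx xz vz
      outside-edge (inj₁ vx)   (inj₂ refl) = w↮N[v] x vx (Edge-sym xz)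
      outside-edge (inj₂ refl) (inj₁ vz)   = w↮N[v] z vz xz
      outside-edge (inj₂ refl) (inj₂ refl) = Edge⇒≢ xz refl

  -- Matchings

  NearPerfect : Fin n → List (Fin n × Fin n) → Set
  NearPerfect v M = IsMatching G M × ¬ (v ∈ covered G M) × (∀ u → u ≢ v → u ∈ covered G M)

  length-covered : ∀ M → length (covered G M) ≡ length M + length M
  length-covered []      = refl
  length-covered (e ∷ M) =
    cong suc (trans (cong suc (length-covered M)) (sym (+-suc (length M) (length M))))

  matching-size : ∀ {M} → IsMatching G M → length M + length M ≤ n
  matching-size {M} (_ , unique) = subst (_≤ n) (length-covered M) (unique⇒length≤ unique)

  near-perfect-size : ∀ {v M} → NearPerfect v M → suc (length M + length M) ≡ n
  near-perfect-size {v} {M} ((_ , unique) , v∉ , covering) =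
    trans (cong suc (sym (length-covered M)))
          (unique∧covering⇒length≡ (¬Any⇒All¬ _ v∉ ∷ unique) covers)
    where
    covers : ∀ z → z ∈ v ∷ covered G M
    covers z with z ≟ v
    ... | yes refl = here refl
    ... | no  z≢v  = there (covering z z≢v)

  near-perfect? : ∀ v M → Dec (NearPerfect v M)
  near-perfect? v M =
    (All.all? (λ e → Edge? (proj₁ e) (proj₂ e)) M ×-dec unique? (covered G M))
    ×-dec ¬? (v ∈? covered G M)
    ×-dec all? (λ u → ¬? (u ≟ v) →-dec (u ∈? covered G M))

  factorCritical-matchingNumber : FactorCritical G → Fin n →
                                  ∃ λ m → n ≡ suc (m + m) × MatchingNumber G m
  factorCritical-matchingNumber fc v with fc v
  ... | M , near-perfect@(matching , _) = length M , order , (M , matching , refl) , maximum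
    where
    order : n ≡ suc (length M + length M)
    order = sym (near-perfect-size near-perfect)
    maximum : ∀ M′ → IsMatching G M′ → length M′ ≤ length M
    maximum M′ matching′ = half-≤ (subst (length M′ + length M′ ≤_) order (matching-size matching′))

  matchingNumber-unique : ∀ {k m} → MatchingNumber G k → MatchingNumber G m → k ≡ m
  matchingNumber-unique ((M , matching , refl) , maximum) ((M′ , matching′ , refl) , maximum′) =
    ≤-antisym (maximum′ M matching) (maximum M′ matching′)

  order-of-factorCritical : ∀ {k} → FactorCritical G → MatchingNumber G k → 0 < k → n ≡ suc (k + k)
  order-of-factorCritical {k} fc ν≡k@((_ , matching , refl) , _) 0<k
    with factorCritical-matchingNumber fc (fromℕ< (<-≤-trans (+-mono-< 0<k 0<k) (matching-size matching)))
  ... | m , order , ν≡m =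
    subst (λ k → n ≡ suc (k + k)) (sym (matchingNumber-unique ν≡k ν≡m)) order

  matchingNumber-of-factorCritical : ∀ {k} → FactorCritical G → n ≡ suc (k + k) → MatchingNumber G k
  matchingNumber-of-factorCritical {k} fc order
    with factorCritical-matchingNumber fc (subst Fin (sym order) zero)
  ... | m , order′ , ν≡m =
    subst (MatchingNumber G) (double-injective (suc-injective (trans (sym order′) order))) ν≡m

  triangleFree? : Dec (TriangleFree G)
  triangleFree? = all? λ u → all? λ v → all? λ w →
    Edge? u v →-dec Edge? v w →-dec Edge? u w →-dec no λ ()

  degreeCondition? : ∀ d → Dec (DegreeCondition G d)
  degreeCondition? d = ((d % 2 ≟ℕ 0) →-dec regular?) ×-dec ((d % 2 ≟ℕ 1) →-dec almostRegular?)
    where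
    regular? : Dec (Regular G d)
    regular? = all? λ v → degree G v ≟ℕ d
    almostRegular? : Dec (AlmostRegular G d)
    almostRegular? = any? λ v →
      (degree G v ≟ℕ d ∸ 1) ×-dec all? (λ u → ¬? (u ≟ v) →-dec (degree G u ≟ℕ d))

-- Nearly regular graphs

record NearlyRegular (G : Graph) (d : ℕ) : Set where
  field
    degree≤ : ∀ v → degree G v ≤ d
    deficit≤1 : ∑[ v < Graph.n G ] (d ∸ degree G v) ≤ 1

nearlyRegular : ∀ {G d} → DegreeCondition G d → NearlyRegular G d
nearlyRegular {G} {d} (if-even , if-odd) with parity d
... | inj₁ even = record
  { degree≤   = λ v → ≤-reflexive (regular v)
  ; deficit≤1 = subst (_≤ 1) (sym (trans (sum-cong-≗ no-deficit) (∑-zero n))) z≤n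
  }
  where
  open Graph G using (n)
  regular : Regular G d
  regular = if-even even
  no-deficit : ∀ v → d ∸ degree G v ≡ 0
  no-deficit v = trans (cong (d ∸_) (regular v)) (n∸n≡0 d)
... | inj₂ odd with if-odd odd
...   | w , degree-w , regular-elsewhere = record { degree≤ = degree≤ ; deficit≤1 = deficit≤1 }
  where
  open Graph G using (n)
  degree≤ : ∀ v → degree G v ≤ d
  degree≤ v with v ≟ w
  ... | yes refl = subst (_≤ d) (sym degree-w) (m∸n≤m d 1)
  ... | no  v≢w  = ≤-reflexive (regular-elsewhere v v≢w)
  deficit-at-w : ∀ v → d ∸ degree G v ≡ [ does (v ≟ w) ] * (d ∸ degree G v)
  deficit-at-w v with v ≟ w
  ... | yes refl = sym (+-identityʳ _)
  ... | no  v≢w  = trans (cong (d ∸_) (regular-elsewhere v v≢w)) (n∸n≡0 d)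
  d∸[d∸1]≤1 : ∀ d → d ∸ (d ∸ 1) ≤ 1
  d∸[d∸1]≤1 zero    = z≤n
  d∸[d∸1]≤1 (suc d) = ≤-reflexive (m+n∸n≡m 1 d)
  deficit≤1 : ∑[ v < n ] (d ∸ degree G v) ≤ 1
  deficit≤1 = begin
    ∑[ v < n ] (d ∸ degree G v)                       ≡⟨ sum-cong-≗ deficit-at-w ⟩
    ∑[ v < n ] ([ does (v ≟ w) ] * (d ∸ degree G v))  ≡⟨ ∑-[≟]* w (λ v → d ∸ degree G v) ⟩
    d ∸ degree G w                                    ≡⟨ cong (d ∸_) degree-w ⟩
    d ∸ (d ∸ 1)                                       ≤⟨ d∸[d∸1]≤1 d ⟩
    1                                                 ∎
    where open ≤-Reasoning

module _ {G : Graph} (triangle-free : TriangleFree G) {d : ℕ} (nearly-regular : NearlyRegular G d) where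
  open Graph G using (n; adj)
  open NearlyRegular nearly-regular

  full-among : (p : Fin n → Bool) → 1 < ∑[ z < n ] [ p z ] → ∃ λ z → p z ≡ true × degree G z ≡ d
  full-among p 1<#p
    with ∑<∑⇒∃< (λ z → d ∸ degree G z) (λ z → [ p z ]) (≤-<-trans deficit≤1 1<#p)
  ... | z , deficit<[pz] with <[]⇒ (p z) deficit<[pz]
  ...   | pz , no-deficit = z , pz , ≤-antisym (degree≤ z) (m∸n≡0⇒m≤n no-deficit)

  full-edge : 2 ≤ d → 2 ≤ n → ∃ λ u → ∃ λ v → Edge G u v × degree G u ≡ d × degree G v ≡ d
  full-edge 2≤d 2≤n with full-among (λ _ → true) (subst (1 <_) (sym (∑-one n)) 2≤n)
  ... | u , _ , du with full-among (adj u) (subst (1 <_) (trans (sym du) (degree-∑ G u)) 2≤d)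
  ...   | v , uv , dv = u , v , uv , du , dv

  d+d≤order : 2 ≤ d → 2 ≤ n → d + d ≤ n
  d+d≤order 2≤d 2≤n with full-edge 2≤d 2≤n
  ... | u , v , uv , du , dv = subst (_≤ n) (cong₂ _+_ du dv) (degree+degree≤order G triangle-free uv)

  ∑[]*d≤∑[]*degree+1 : (p : Fin n → Bool) →
                       ∑[ z < n ] ([ p z ] * d) ≤ ∑[ z < n ] ([ p z ] * degree G z) + 1
  ∑[]*d≤∑[]*degree+1 p = begin
    ∑[ z < n ] ([ p z ] * d)
      ≤⟨ ∑-mono-≤ (λ z → deficit-covers (p z) z) ⟩
    ∑[ z < n ] ([ p z ] * degree G z + (d ∸ degree G z))
      ≡⟨ ∑-distrib-+ (λ z → [ p z ] * degree G z) (λ z → d ∸ degree G z) ⟩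
    ∑[ z < n ] ([ p z ] * degree G z) + ∑[ z < n ] (d ∸ degree G z)
      ≤⟨ +-monoʳ-≤ _ deficit≤1 ⟩
    ∑[ z < n ] ([ p z ] * degree G z) + 1 ∎
    where
    open ≤-Reasoning
    deficit-covers : ∀ b z → [ b ] * d ≤ [ b ] * degree G z + (d ∸ degree G z)
    deficit-covers true  z rewrite +-identityʳ d | +-identityʳ (degree G z) =
      m≤n+m∸n d (degree G z)
    deficit-covers false z = z≤n

  degree-sum-of-distinct : ∀ {L} → Unique L → length L * d ≤ sumᴸ (map (degree G) L) + 1
  degree-sum-of-distinct {L} distinct = begin
    length L * d
      ≡⟨ sumᴸ-map-const d L ⟨
    sumᴸ (map (λ _ → d) L)
      ≡⟨ ∑-[∈]* distinct (λ _ → d) ⟨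
    ∑[ z < n ] ([ does (z ∈? L) ] * d)
      ≤⟨ ∑[]*d≤∑[]*degree+1 (λ z → does (z ∈? L)) ⟩
    ∑[ z < n ] ([ does (z ∈? L) ] * degree G z) + 1
      ≡⟨ cong (_+ 1) (∑-[∈]* distinct (degree G)) ⟩
    sumᴸ (map (degree G) L) + 1 ∎
    where open ≤-Reasoning

  module _ (order : n ≡ suc (d + d)) where

    pentagon-free : 4 ≤ d → ∀ {u v y w x} → Edge G u v → degree G u ≡ d → degree G v ≡ d →
                    Edge G v y → Edge G y w → Edge G w x → Edge G x u → ⊥
    pentagon-free 4≤d {u} {v} {y} {w} {x} uv du dv vy yw wx xu =
      ≤⇒≯ (pentagon-arithmetic d _ five (degree-sum-of-distinct distinct)) 4≤d
      where
      y≢x : y ≢ x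
      y≢x refl = triangle-free u v y uv vy (Edge-sym G xu)
      distinct : Unique (y ∷ w ∷ x ∷ [])
      distinct = (Edge⇒≢ G yw ∷ y≢x ∷ []) ∷ (Edge⇒≢ G wx ∷ []) ∷ [] ∷ []
      five : d + (d + sumᴸ (map (degree G) (y ∷ w ∷ x ∷ []))) ≤ suc (d + d) * 2
      five = subst₂ _≤_
               (cong₂ (λ a b → a + (b + sumᴸ (map (degree G) (y ∷ w ∷ x ∷ [])))) du dv)
               (cong (_* 2) order)
               (pentagon-degree-sum G triangle-free uv vy yw wx xu)
      pentagon-arithmetic : ∀ d D → d + (d + D) ≤ suc (d + d) * 2 → 3 * d ≤ D + 1 → d ≤ 3
      pentagon-arithmetic d D five three = +-cancelˡ-≤ (4 * d) d 3 (begin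
        4 * d + d            ≡⟨ e₁ d ⟩
        d + d + 3 * d        ≤⟨ +-monoʳ-≤ (d + d) three ⟩
        d + d + (D + 1)      ≡⟨ e₂ d D ⟩
        d + (d + D) + 1      ≤⟨ +-monoˡ-≤ 1 five ⟩
        suc (d + d) * 2 + 1  ≡⟨ e₃ d ⟩
        4 * d + 3            ∎)
        where
        open ≤-Reasoning
        e₁ : ∀ d → 4 * d + d ≡ d + d + 3 * d
        e₁ = solve-∀
        e₂ : ∀ d D → d + d + (D + 1) ≡ d + (d + D) + 1
        e₂ = solve-∀
        e₃ : ∀ d → suc (d + d) * 2 + 1 ≡ 4 * d + 3
        e₃ = solve-∀

    not-bipartite : 2 ≤ d → ∀ {u} → degree G u ≡ d →
                    (∀ x z → Edge G x z → adj u z ≡ not (adj u x)) → ⊥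
    not-bipartite 2≤d {u} du crossing = ≤⇒≯ (+-cancelʳ-≤ (d * d) d 1 chain) 2≤d
      where
      #non-neighbours : ∑[ z < n ] [ not (adj u z) ] ≡ suc d
      #non-neighbours = +-cancelˡ-≡ d _ _ (begin
        d + ∑[ z < n ] [ not (adj u z) ]
          ≡⟨ cong (_+ ∑[ z < n ] [ not (adj u z) ]) (trans (sym du) (degree-∑ G u)) ⟩
        ∑[ z < n ] [ adj u z ] + ∑[ z < n ] [ not (adj u z) ]
          ≡⟨ ∑-complement (adj u) ⟩
        n
          ≡⟨ trans order (sym (+-suc d d)) ⟩
        d + suc d ∎)
        where open ≡-Reasoning
      chain : suc d * d ≤ 1 + d * d
      chain = begin
        suc d * d
          ≡⟨ cong (_* d) #non-neighbours ⟨
        ∑[ z < n ] [ not (adj u z) ] * d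
          ≡⟨ ∑-*ʳ (λ z → [ not (adj u z) ]) d ⟨
        ∑[ z < n ] ([ not (adj u z) ] * d)
          ≤⟨ ∑[]*d≤∑[]*degree+1 (λ z → not (adj u z)) ⟩
        ∑[ z < n ] ([ not (adj u z) ] * degree G z) + 1
          ≡⟨ cong (_+ 1) (bipartite-degree-sums G (adj u) crossing) ⟨
        ∑[ x < n ] ([ adj u x ] * degree G x) + 1
          ≤⟨ +-monoˡ-≤ 1 (∑-mono-≤ (λ x → *-monoʳ-≤ [ adj u x ] (degree≤ x))) ⟩
        ∑[ x < n ] ([ adj u x ] * d) + 1
          ≡⟨ cong (_+ 1) (∑-*ʳ (λ x → [ adj u x ]) d) ⟩
        ∑[ x < n ] [ adj u x ] * d + 1
          ≡⟨ cong (λ m → m * d + 1) (trans (sym (degree-∑ G u)) du) ⟩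
        d * d + 1
          ≡⟨ +-comm (d * d) 1 ⟩
        1 + d * d ∎
        where open ≤-Reasoning

    outside-vertex : ∀ {u v} → Edge G u v → degree G u ≡ d → degree G v ≡ d →
                     ∃ λ w → ∀ z → adj u z ≡ false → adj v z ≡ false → z ≡ w
    outside-vertex {u} {v} uv du dv = w , outside-is-w
      where
      outside : Fin n → Bool
      outside z = not (adj u z ∨ adj v z)
      #outside : ∑[ z < n ] [ outside z ] ≡ 1
      #outside = +-cancelˡ-≡ (d + d) _ _ (begin
        d + d + ∑[ z < n ] [ outside z ]
          ≡⟨ cong₂ (λ a b → a + b + ∑[ z < n ] [ outside z ]) du dv ⟨
        degree G u + degree G v + ∑[ z < n ] [ outside z ]
          ≡⟨ cong (_+ ∑[ z < n ] [ outside z ]) (∑[∨]≡degree+degree G triangle-free uv) ⟨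
        ∑[ z < n ] [ adj u z ∨ adj v z ] + ∑[ z < n ] [ outside z ]
          ≡⟨ ∑-complement (λ z → adj u z ∨ adj v z) ⟩
        n
          ≡⟨ trans order (+-comm 1 (d + d)) ⟩
        d + d + 1 ∎)
        where open ≡-Reasoning
      some-outside : ∃ λ w → 0 < [ outside w ]
      some-outside =
        ∑<∑⇒∃< (λ _ → 0) (λ z → [ outside z ]) (subst₂ _<_ (sym (∑-zero n)) (sym #outside) z<s)
      w : Fin n
      w = proj₁ some-outside
      outside-is-w : ∀ z → adj u z ≡ false → adj v z ≡ false → z ≡ w
      outside-is-w z uz vz with z ≟ w
      ... | yes z≡w = z≡w
      ... | no  z≢w = contradiction
                        (subst₂ _≤_ two-outside #outside (sumᴸ-map≤∑ ((z≢w ∷ []) ∷ [] ∷ []) [outside]))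
                        λ { (s≤s ()) }
        where
        [outside] : Fin n → ℕ
        [outside] z = [ outside z ]
        two-outside : [ outside z ] + ([ outside w ] + 0) ≡ 2
        two-outside = cong₂ (λ a b → [ a ] + ([ b ] + 0)) (cong₂ (λ a b → not (a ∨ b)) uz vz)
                        (proj₁ (<[]⇒ (outside w) (proj₂ some-outside)))

  order≢2d+1 : 4 ≤ d → n ≢ suc (d + d)
  order≢2d+1 4≤d order = no-full-edge (full-edge 2≤d 2≤n)
    where
    2≤d : 2 ≤ d
    2≤d = ≤-trans (s≤s (s≤s z≤n)) 4≤d
    2≤n : 2 ≤ n
    2≤n = subst (2 ≤_) (sym order) (s≤s (≤-trans (≤-trans (s≤s z≤n) 2≤d) (m≤m+n d d)))
    no-full-edge : ¬ ∃ λ u → ∃ λ v → Edge G u v × degree G u ≡ d × degree G v ≡ d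
    no-full-edge (u , v , uv , du , dv) with outside-vertex order uv du dv
    ... | w , outside-is-w with any? (λ y → Edge? G v y ×-dec Edge? G w y)
    ...   | no ∄y = not-bipartite order 2≤d du
                      (neighbourhood-side G triangle-free uv outside-is-w λ y vy wy → ∄y (y , vy , wy))
    ...   | yes (y , vy , wy) with any? (λ x → Edge? G u x ×-dec Edge? G w x)
    ...     | no ∄x = not-bipartite order 2≤d dv
                        (neighbourhood-side G triangle-free (Edge-sym G uv) (λ z vz uz → outside-is-w z uz vz)
                          λ x ux wx → ∄x (x , ux , wx))
    ...     | yes (x , ux , wx) = pentagon-free order 4≤d uv du dv vy (Edge-sym G wy) wx (Edge-sym G ux)

-- Realizations

ν≥d : ∀ {d k} → 2 ≤ d → 0 < k → Realizable d k → d ≤ k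
ν≥d {d} {k} 2≤d 0<k (G , triangle-free , fc , ν≡k , degree-condition) =
  half-≤ (subst (d + d ≤_) order (d+d≤order {G} triangle-free (nearlyRegular {G} degree-condition) 2≤d 2≤n))
  where
  order : Graph.n G ≡ suc (k + k)
  order = order-of-factorCritical G fc ν≡k 0<k
  2≤n : 2 ≤ Graph.n G
  2≤n = subst (2 ≤_) (sym order) (s≤s (≤-trans 0<k (m≤m+n k k)))

ν≢d : ∀ {d} → 4 ≤ d → ¬ Realizable d d
ν≢d 4≤d (G , triangle-free , fc , ν≡d , degree-condition) =
  order≢2d+1 {G} triangle-free (nearlyRegular {G} degree-condition) 4≤d
    (order-of-factorCritical G fc ν≡d (≤-trans (s≤s z≤n) 4≤d))

module OddTable (k : ℕ) (table : ℕ → List ℕ) where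

  N : ℕ
  N = suc (k + k)

  adjacency : Fin N → Fin N → Bool
  adjacency u v = does (toℕ v ∈ℕ? table (toℕ u))

  module _ {symmetric : True (all? λ u → all? λ v → adjacency u v ≟ᵇ adjacency v u)}
           {loopless : True (all? λ v → adjacency v v ≟ᵇ false)} where

    graph : Graph
    graph = record { n = N ; adj = adjacency ; sym = toWitness symmetric ; loopless = toWitness loopless }

    -- Every table contains the odd cycle 0, 1, …, 2k; deleting v from it leaves a path
    -- with perfect matching {v+1, v+2}, {v+3, v+4}, …
    rotation : Fin N → List (Fin N × Fin N)
    rotation v = applyUpTo (λ i → vertex (toℕ v + suc (i + i)) , vertex (toℕ v + suc (suc (i + i)))) k
      where
      vertex : ℕ → Fin N
      vertex m = fromℕ< (m%n<n m N)

    realizable : ∀ d → {True (triangleFree? graph)} →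
                 {True (all? λ v → near-perfect? graph v (rotation v))} →
                 {True (degreeCondition? graph d)} → Realizable d k
    realizable d {triangle-free} {near-perfect} {degree-condition} =
      graph , toWitness triangle-free , fc , matchingNumber-of-factorCritical graph fc refl ,
      toWitness degree-condition
      where
      fc : FactorCritical graph
      fc v = rotation v , toWitness near-perfect v

cycle₅ : ℕ → List ℕ
cycle₅ 0 = 1 ∷ 4 ∷ []
cycle₅ 1 = 0 ∷ 2 ∷ []
cycle₅ 2 = 1 ∷ 3 ∷ []
cycle₅ 3 = 2 ∷ 4 ∷ []
cycle₅ 4 = 3 ∷ 0 ∷ []
cycle₅ _ = []

subcubic₇ : ℕ → List ℕ
subcubic₇ 0 = 1 ∷ 6 ∷ []
subcubic₇ 1 = 0 ∷ 2 ∷ 4 ∷ []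
subcubic₇ 2 = 1 ∷ 3 ∷ 5 ∷ []
subcubic₇ 3 = 2 ∷ 4 ∷ 6 ∷ []
subcubic₇ 4 = 1 ∷ 3 ∷ 5 ∷ []
subcubic₇ 5 = 2 ∷ 4 ∷ 6 ∷ []
subcubic₇ 6 = 0 ∷ 3 ∷ 5 ∷ []
subcubic₇ _ = []

quartic₁₁ : ℕ → List ℕ
quartic₁₁ 0  = 1 ∷ 4 ∷ 8 ∷ 10 ∷ []
quartic₁₁ 1  = 0 ∷ 2 ∷ 7 ∷ 9 ∷ []
quartic₁₁ 2  = 1 ∷ 3 ∷ 5 ∷ 10 ∷ []
quartic₁₁ 3  = 2 ∷ 4 ∷ 6 ∷ 8 ∷ []
quartic₁₁ 4  = 0 ∷ 3 ∷ 5 ∷ 7 ∷ []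
quartic₁₁ 5  = 2 ∷ 4 ∷ 6 ∷ 9 ∷ []
quartic₁₁ 6  = 3 ∷ 5 ∷ 7 ∷ 10 ∷ []
quartic₁₁ 7  = 1 ∷ 4 ∷ 6 ∷ 8 ∷ []
quartic₁₁ 8  = 0 ∷ 3 ∷ 7 ∷ 9 ∷ []
quartic₁₁ 9  = 1 ∷ 5 ∷ 8 ∷ 10 ∷ []
quartic₁₁ 10 = 0 ∷ 2 ∷ 6 ∷ 9 ∷ []
quartic₁₁ _  = []

subquintic₁₃ : ℕ → List ℕ
subquintic₁₃ 0  = 1 ∷ 4 ∷ 9 ∷ 12 ∷ []
subquintic₁₃ 1  = 0 ∷ 2 ∷ 5 ∷ 7 ∷ 11 ∷ []
subquintic₁₃ 2  = 1 ∷ 3 ∷ 6 ∷ 8 ∷ 10 ∷ []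
subquintic₁₃ 3  = 2 ∷ 4 ∷ 7 ∷ 9 ∷ 12 ∷ []
subquintic₁₃ 4  = 0 ∷ 3 ∷ 5 ∷ 8 ∷ 11 ∷ []
subquintic₁₃ 5  = 1 ∷ 4 ∷ 6 ∷ 10 ∷ 12 ∷ []
subquintic₁₃ 6  = 2 ∷ 5 ∷ 7 ∷ 9 ∷ 11 ∷ []
subquintic₁₃ 7  = 1 ∷ 3 ∷ 6 ∷ 8 ∷ 10 ∷ []
subquintic₁₃ 8  = 2 ∷ 4 ∷ 7 ∷ 9 ∷ 12 ∷ []
subquintic₁₃ 9  = 0 ∷ 3 ∷ 6 ∷ 8 ∷ 10 ∷ []
subquintic₁₃ 10 = 2 ∷ 5 ∷ 7 ∷ 9 ∷ 11 ∷ []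
subquintic₁₃ 11 = 1 ∷ 4 ∷ 6 ∷ 10 ∷ 12 ∷ []
subquintic₁₃ 12 = 0 ∷ 3 ∷ 5 ∷ 8 ∷ 11 ∷ []
subquintic₁₃ _  = []

realizable-2-2 : Realizable 2 2
realizable-2-2 = OddTable.realizable 2 cycle₅ 2

realizable-3-3 : Realizable 3 3
realizable-3-3 = OddTable.realizable 3 subcubic₇ 3

realizable-4-5 : Realizable 4 5
realizable-4-5 = OddTable.realizable 5 quartic₁₁ 4

realizable-5-6 : Realizable 5 6
realizable-5-6 = OddTable.realizable 6 subquintic₁₃ 5

unrealizable-below : ∀ {d k} → 2 ≤ d → 0 < k → k < d → ¬ Realizable d k
unrealizable-below 2≤d 0<k k<d realization = <⇒≱ k<d (ν≥d 2≤d 0<k realization)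

unrealizable : ∀ d → 4 ≤ d → ∀ k → 0 < k → k ≤ d → ¬ Realizable d k
unrealizable d 4≤d k 0<k k≤d with m≤n⇒m<n∨m≡n k≤d
... | inj₁ k<d  = unrealizable-below (≤-trans (s≤s (s≤s z≤n)) 4≤d) 0<k k<d
... | inj₂ refl = ν≢d 4≤d

lemma7 : IsZ 2 2 × IsZ 3 3 × IsZ 4 5 × IsZ 5 6 ×
           (∀ d → 4 ≤ d → ∀ k → 0 < k → k ≤ d → ¬ Realizable d k)
lemma7 = (z<s , realizable-2-2 , λ k 0<k k<2 → unrealizable-below ≤-refl 0<k k<2)
       , (z<s , realizable-3-3 , λ k 0<k k<3 → unrealizable-below (n≤1+n 2) 0<k k<3)
       , (z<s , realizable-4-5 , λ k 0<k k<5 → unrealizable 4 ≤-refl k 0<k (≤-pred k<5))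
       , (z<s , realizable-5-6 , λ k 0<k k<6 → unrealizable 5 (n≤1+n 4) k 0<k (≤-pred k<6))
       , unrealizable
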